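{- Let $n$ be a positive integer and let $\omega$ be a vector chosen uniformly at random from $\{1,i,-1,-i\}^n$. Then for every $a\in\mathbb{C}^n$, $$4\,\mathbb{E}_\omega\big[\Lambda(a\circ\omega)^2\big]=\|a\|_{\ell_2}^4-\|a\|_{\ell_4}^4.$$
   Context: $a\circ\omega=(a_1\omega_1,\dots,a_n\omega_n)$ is the entrywise product. For $b\in\mathbb{C}^n$ with real and imaginary parts $\mathrm{Re}(b),\mathrm{Im}(b)\in\mathbb{R}^n$, $\Lambda(b)=\sqrt{\|\mathrm{Re}(b)\|_{\ell_2}^2\|\mathrm{Im}(b)\|_{\ell_2}^2-\langle\mathrm{Re}(b),\mathrm{Im}(b)\rangle^2}$. $\|a\|_{\ell_p}=(\sum_i|a_i|^p)^{1/p}$. -}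

module Defs where

open import Algebra.Bundles using (CommutativeRing)
open import Data.Nat using (ℕ; zero; suc)
open import Data.Fin using (Fin; zero; suc)
open import Data.Product using (_×_; _,_; proj₁; proj₂)
open import Function using (_∘_)
import Data.Vec.Functional as VF

-- Complex numbers over a commutative ring R are pairs (real part, imaginary part).
-- All quantities in the statement are polynomial in real/imaginary parts.
module WithRing {c ℓ} (R : CommutativeRing c ℓ) where
  open CommutativeRing R public using (Carrier; _≈_; _+_; _*_; -_; 0#; 1#)

  _⊖_ : Carrier → Carrier → Carrier
  x ⊖ y = x + (- y)

  ℂ : Set c
  ℂ = Carrier × Carrier

  Re Im : ℂ → Carrier
  Re = proj₁
  Im = proj₂

  _·ℂ_ : ℂ → ℂ → ℂ
  (x , y) ·ℂ (u , v) = ((x * u) ⊖ (y * v)) , ((x * v) + (y * u))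

  absSq : ℂ → Carrier
  absSq z = (Re z * Re z) + (Im z * Im z)

  Σ : (n : ℕ) → (Fin n → Carrier) → Carrier
  Σ zero    f = 0#
  Σ (suc n) f = f zero + Σ n (f ∘ suc)

  natR : ℕ → Carrier
  natR zero    = 0#
  natR (suc k) = 1# + natR k

  -- the fourth roots of unity: k ↦ i^k, i.e. 1, i, -1, -i
  root : Fin 4 → ℂ
  root zero                   = 1# , 0#
  root (suc zero)             = 0# , 1#
  root (suc (suc zero))       = (- 1#) , 0#
  root (suc (suc (suc zero))) = 0# , (- 1#)

  -- ω ∈ {1,i,-1,-i}^n, encoded by exponents Fin n → Fin 4
  Ω : ℕ → Set
  Ω n = Fin n → Fin 4

  sumΩ : (n : ℕ) → (Ω n → Carrier) → Carrier
  sumΩ zero    f = f (λ ())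
  sumΩ (suc n) f = Σ 4 (λ k → sumΩ n (λ ω → f (k VF.∷ ω)))

  hadamard : {n : ℕ} → (Fin n → ℂ) → Ω n → (Fin n → ℂ)
  hadamard a ω i = a i ·ℂ root (ω i)

  inner : {n : ℕ} → (Fin n → Carrier) → (Fin n → Carrier) → Carrier
  inner {n} u v = Σ n (λ i → u i * v i)

  ΛSq : {n : ℕ} → (Fin n → ℂ) → Carrier
  ΛSq b = (inner (Re ∘ b) (Re ∘ b) * inner (Im ∘ b) (Im ∘ b))
          ⊖ (inner (Re ∘ b) (Im ∘ b) * inner (Re ∘ b) (Im ∘ b))

  norm2⁴ : {n : ℕ} → (Fin n → ℂ) → Carrier
  norm2⁴ {n} a = Σ n (absSq ∘ a) * Σ n (absSq ∘ a)

  norm4⁴ : {n : ℕ} → (Fin n → ℂ) → Carrier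
  norm4⁴ {n} a = Σ n (λ i → absSq (a i) * absSq (a i))

-- Write b = a ∘ ω, P = ‖Re b‖², Q = ‖Im b‖², M = ⟨Re b, Im b⟩. Then
-- 4 (PQ − M²) = (P + Q)² − |P − Q + 2iM|² = ‖b‖₂⁴ − |Σⱼ bⱼ²|², and ‖b‖₂ = ‖a‖₂
-- because |ωⱼ| = 1. Since bⱼ² = aⱼ² ωⱼ² and the signs ωⱼ² = ±1 are independent
-- and centred, the cross terms of |Σⱼ aⱼ² ωⱼ²|² average out, leaving
-- Σⱼ |aⱼ|⁴ = ‖a‖₄⁴.
module Submission where

open import Defs
open import Algebra.Bundles using (CommutativeRing; RawRing)
open import Data.Fin using (Fin; zero; suc)
open import Data.Maybe using (Maybe; just; nothing)
open import Data.Nat as ℕ using (ℕ; zero; suc; _≤_; _^_)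
open import Data.Product using (_×_; _,_; proj₁; proj₂)
open import Function using (_∘_)
open import Relation.Nullary using (yes; no)
open import Relation.Binary.PropositionalEquality as ≡ using (_≡_)
import Algebra.Solver.Ring
import Algebra.Solver.Ring.AlmostCommutativeRing as ACR
import Data.Product.Properties as Product
import Data.Vec.Functional as Vector

-- Algebra.Solver.Ring needs a coefficient ring mapping into R whose normal forms
-- cancel; the library only instantiates it with ℕ, which cannot cancel x − x.
module IntegerCoefficientRingSolver {c ℓ} (R : CommutativeRing c ℓ) where
  open CommutativeRing R hiding (zero)
  open import Algebra.Properties.Semiring.Mult.TCOptimised semiring using (1+×; ×-homo-+; ×1-homo-*) renaming (_×_ to _×′_)
  open import Algebra.Properties.Group +-group using (∙-cancelʳ)
  open import Algebra.Properties.CommutativeSemigroup +-commutativeSemigroup using (interchange; x∙yz≈y∙xz)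
  open import Algebra.Solver.Ring.NaturalCoefficients.Default commutativeSemiring as ℕ-Solver using ()
  open import Relation.Binary.Reasoning.Setoid setoid

  -- (p , n) stands for p − n. The operations below keep pairs reduced, so that
  -- equal integers have identical representations.
  Diff : Set
  Diff = ℕ × ℕ

  reduce : Diff → Diff
  reduce (p , zero)      = p , zero
  reduce (zero , suc n)  = zero , suc n
  reduce (suc p , suc n) = reduce (p , n)

  -- With the optimised _×′_, ι 0 and ι 1 are 0# and 1# on the nose, so the
  -- constants 0 and 1 of a polynomial denote 0# and 1# definitionally.
  ι : ℕ → Carrier
  ι n = n ×′ 1#

  ⟦_⟧ : Diff → Carrier
  ⟦ p , zero ⟧      = ι p
  ⟦ zero , suc n ⟧  = - ι (suc n)
  ⟦ suc p , suc n ⟧ = ⟦ p , n ⟧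

  ⟦reduce⟧ : ∀ x → ⟦ reduce x ⟧ ≡ ⟦ x ⟧
  ⟦reduce⟧ (p , zero)      = ≡.refl
  ⟦reduce⟧ (zero , suc n)  = ≡.refl
  ⟦reduce⟧ (suc p , suc n) = ⟦reduce⟧ (p , n)

  -- Each homomorphism law follows by adding ι of a second component to both
  -- sides and cancelling, which keeps the computations free of negation.
  ⟦⟧+ι≈ι : ∀ p n → ⟦ p , n ⟧ + ι n ≈ ι p
  ⟦⟧+ι≈ι p       zero    = +-identityʳ (ι p)
  ⟦⟧+ι≈ι zero    (suc n) = -‿inverseˡ (ι (suc n))
  ⟦⟧+ι≈ι (suc p) (suc n) = begin
    ⟦ p , n ⟧ + ι (suc n)    ≈⟨ +-congˡ (1+× n 1#) ⟩
    ⟦ p , n ⟧ + (1# + ι n)   ≈⟨ x∙yz≈y∙xz _ _ _ ⟩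
    1# + (⟦ p , n ⟧ + ι n)   ≈⟨ +-congˡ (⟦⟧+ι≈ι p n) ⟩
    1# + ι p                 ≈⟨ 1+× p 1# ⟨
    ι (suc p)                ∎

  ι-+ : ∀ m n → ι (m ℕ.+ n) ≈ ι m + ι n
  ι-+ = ×-homo-+ 1#

  Diffs : RawRing _ _
  Diffs = record
    { Carrier = Diff ; _≈_ = _≡_
    ; _+_ = λ { (a , b) (c , d) → reduce (a ℕ.+ c , b ℕ.+ d) }
    ; _*_ = λ { (a , b) (c , d) → reduce (a ℕ.* c ℕ.+ b ℕ.* d , a ℕ.* d ℕ.+ b ℕ.* c) }
    ; -_ = λ { (a , b) → b , a }
    ; 0# = 0 , 0
    ; 1# = 1 , 0
    }

  ⟦⟧-+ : ∀ a b c d → ⟦ reduce (a ℕ.+ c , b ℕ.+ d) ⟧ ≈ ⟦ a , b ⟧ + ⟦ c , d ⟧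
  ⟦⟧-+ a b c d = ∙-cancelʳ (ι (b ℕ.+ d)) _ _ (begin
    ⟦ reduce (a ℕ.+ c , b ℕ.+ d) ⟧ + ι (b ℕ.+ d) ≡⟨ ≡.cong (_+ ι (b ℕ.+ d)) (⟦reduce⟧ (a ℕ.+ c , b ℕ.+ d)) ⟩
    ⟦ a ℕ.+ c , b ℕ.+ d ⟧ + ι (b ℕ.+ d)         ≈⟨ ⟦⟧+ι≈ι (a ℕ.+ c) (b ℕ.+ d) ⟩
    ι (a ℕ.+ c)                                 ≈⟨ ι-+ a c ⟩
    ι a + ι c                                   ≈⟨ +-cong (⟦⟧+ι≈ι a b) (⟦⟧+ι≈ι c d) ⟨
    (⟦ a , b ⟧ + ι b) + (⟦ c , d ⟧ + ι d)       ≈⟨ interchange _ _ _ _ ⟩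
    (⟦ a , b ⟧ + ⟦ c , d ⟧) + (ι b + ι d)       ≈⟨ +-congˡ (ι-+ b d) ⟨
    (⟦ a , b ⟧ + ⟦ c , d ⟧) + ι (b ℕ.+ d)       ∎)

  ⟦⟧-* : ∀ a b c d → ⟦ reduce (a ℕ.* c ℕ.+ b ℕ.* d , a ℕ.* d ℕ.+ b ℕ.* c) ⟧ ≈ ⟦ a , b ⟧ * ⟦ c , d ⟧
  ⟦⟧-* a b c d = ∙-cancelʳ (ι (a ℕ.* d ℕ.+ b ℕ.* c)) _ _ (begin
    ⟦ reduce (ac+bd , ad+bc) ⟧ + ι ad+bc                   ≡⟨ ≡.cong (_+ ι ad+bc) (⟦reduce⟧ (ac+bd , ad+bc)) ⟩
    ⟦ ac+bd , ad+bc ⟧ + ι ad+bc                            ≈⟨ ⟦⟧+ι≈ι ac+bd ad+bc ⟩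
    ι ac+bd                                                ≈⟨ ι-+*+ a c b d ⟩
    ι a * ι c + ι b * ι d                                  ≈⟨ +-congʳ (*-cong (⟦⟧+ι≈ι a b) (⟦⟧+ι≈ι c d)) ⟨
    (A + ι b) * (C + ι d) + ι b * ι d                      ≈⟨ regroup ⟩
    A * C + ((A + ι b) * ι d + ι b * (C + ι d))            ≈⟨ +-congˡ (+-cong (*-congʳ (⟦⟧+ι≈ι a b)) (*-congˡ (⟦⟧+ι≈ι c d))) ⟩
    A * C + (ι a * ι d + ι b * ι c)                        ≈⟨ +-congˡ (ι-+*+ a d b c) ⟨
    A * C + ι ad+bc                                        ∎)
    where
    open ℕ-Solver using (solve; _:+_; _:*_; _:=_)
    ac+bd ad+bc : ℕ
    ac+bd = a ℕ.* c ℕ.+ b ℕ.* d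
    ad+bc = a ℕ.* d ℕ.+ b ℕ.* c
    A C : Carrier
    A = ⟦ a , b ⟧
    C = ⟦ c , d ⟧
    regroup : (A + ι b) * (C + ι d) + ι b * ι d ≈ A * C + ((A + ι b) * ι d + ι b * (C + ι d))
    regroup = solve 4 (λ A C b d → (A :+ b) :* (C :+ d) :+ b :* d
                                   := A :* C :+ ((A :+ b) :* d :+ b :* (C :+ d))) refl A C (ι b) (ι d)
    ι-+*+ : ∀ m n p q → ι (m ℕ.* n ℕ.+ p ℕ.* q) ≈ ι m * ι n + ι p * ι q
    ι-+*+ m n p q = trans (ι-+ (m ℕ.* n) (p ℕ.* q)) (+-cong (×1-homo-* m n) (×1-homo-* p q))

  ⟦⟧-neg : ∀ a b → ⟦ b , a ⟧ ≈ - ⟦ a , b ⟧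
  ⟦⟧-neg a b = ∙-cancelʳ (ι a) _ _ (begin
    ⟦ b , a ⟧ + ι a               ≈⟨ ⟦⟧+ι≈ι b a ⟩
    ι b                           ≈⟨ +-identityˡ (ι b) ⟨
    0# + ι b                      ≈⟨ +-congʳ (-‿inverseˡ A) ⟨
    (- A + A) + ι b               ≈⟨ +-assoc (- A) A (ι b) ⟩
    - A + (A + ι b)               ≈⟨ +-congˡ (⟦⟧+ι≈ι a b) ⟩
    - A + ι a                     ∎)
    where
    A : Carrier
    A = ⟦ a , b ⟧

  ⟦⟧-homomorphism : Diffs ACR.-Raw-AlmostCommutative⟶ ACR.fromCommutativeRing R
  ⟦⟧-homomorphism = record
    { ⟦_⟧    = ⟦_⟧
    ; +-homo = λ (a , b) (c , d) → ⟦⟧-+ a b c d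
    ; *-homo = λ (a , b) (c , d) → ⟦⟧-* a b c d
    ; -‿homo = λ (a , b) → ⟦⟧-neg a b
    ; 0-homo = refl
    ; 1-homo = refl
    }

  _≟⟦⟧_ : ∀ x y → Maybe (⟦ x ⟧ ≈ ⟦ y ⟧)
  x ≟⟦⟧ y with Product.≡-dec ℕ._≟_ ℕ._≟_ x y
  ... | yes ≡.refl = just refl
  ... | no _       = nothing

  open Algebra.Solver.Ring Diffs (ACR.fromCommutativeRing R) ⟦⟧-homomorphism _≟⟦⟧_ public
    using (Polynomial; con; _:+_; _:*_; :-_; _:-_; _:×_; solve; _:=_)


module FiniteSums {c ℓ} (R : CommutativeRing c ℓ) where
  open CommutativeRing R hiding (zero; Carrier; _≈_; _+_; _*_; -_; 0#; 1#)
  open WithRing R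
  open import Algebra.Properties.AbelianGroup +-abelianGroup using (⁻¹-∙-comm)
  open import Algebra.Properties.Group +-group using (ε⁻¹≈ε)
  open import Algebra.Properties.CommutativeSemigroup +-commutativeSemigroup using (interchange)
  open import Algebra.Properties.Semiring.Mult semiring using (×1-homo-*) renaming (_×_ to _×ᵤ_)
  open import Relation.Binary.Reasoning.Setoid setoid

  Σ-cong : ∀ n {f g : Fin n → Carrier} → (∀ i → f i ≈ g i) → Σ n f ≈ Σ n g
  Σ-cong zero    f≈g = refl
  Σ-cong (suc n) f≈g = +-cong (f≈g zero) (Σ-cong n (f≈g ∘ suc))

  Σ-distrib-+ : ∀ n (f g : Fin n → Carrier) → Σ n (λ i → f i + g i) ≈ Σ n f + Σ n g
  Σ-distrib-+ zero    f g = sym (+-identityʳ 0#)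
  Σ-distrib-+ (suc n) f g = trans (+-congˡ (Σ-distrib-+ n (f ∘ suc) (g ∘ suc))) (interchange _ _ _ _)

  Σ-distrib-neg : ∀ n (f : Fin n → Carrier) → Σ n (λ i → - f i) ≈ - Σ n f
  Σ-distrib-neg zero    f = sym ε⁻¹≈ε
  Σ-distrib-neg (suc n) f = trans (+-congˡ (Σ-distrib-neg n (f ∘ suc))) (⁻¹-∙-comm _ _)

  Σ-distrib-⊖ : ∀ n (f g : Fin n → Carrier) → Σ n (λ i → f i ⊖ g i) ≈ Σ n f ⊖ Σ n g
  Σ-distrib-⊖ n f g = trans (Σ-distrib-+ n f (λ i → - g i)) (+-congˡ (Σ-distrib-neg n g))

  *-distribˡ-Σ : ∀ n x (f : Fin n → Carrier) → x * Σ n f ≈ Σ n (λ i → x * f i)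
  *-distribˡ-Σ zero    x f = zeroʳ x
  *-distribˡ-Σ (suc n) x f = trans (distribˡ x _ _) (+-congˡ (*-distribˡ-Σ n x (f ∘ suc)))

  *-distribʳ-Σ : ∀ n x (f : Fin n → Carrier) → Σ n f * x ≈ Σ n (λ i → f i * x)
  *-distribʳ-Σ zero    x f = zeroˡ x
  *-distribʳ-Σ (suc n) x f = trans (distribʳ x _ _) (+-congˡ (*-distribʳ-Σ n x (f ∘ suc)))

  natR≡×1# : ∀ n → natR n ≡ n ×ᵤ 1#
  natR≡×1# zero    = ≡.refl
  natR≡×1# (suc n) = ≡.cong (1# +_) (natR≡×1# n)

  natR-* : ∀ m n → natR (m ℕ.* n) ≈ natR m * natR n
  natR-* m n rewrite natR≡×1# (m ℕ.* n) | natR≡×1# m | natR≡×1# n = ×1-homo-* m n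

  Σ-const : ∀ n x → Σ n (λ _ → x) ≈ natR n * x
  Σ-const zero    x = sym (zeroˡ x)
  Σ-const (suc n) x = begin
    x + Σ n (λ _ → x)    ≈⟨ +-cong (sym (*-identityˡ x)) (Σ-const n x) ⟩
    1# * x + natR n * x  ≈⟨ distribʳ x 1# (natR n) ⟨
    natR (suc n) * x     ∎

  Σ-comm : ∀ m n (f : Fin m → Fin n → Carrier) → Σ m (λ i → Σ n (f i)) ≈ Σ n (λ j → Σ m (λ i → f i j))
  Σ-comm zero    n f = sym (trans (Σ-const n 0#) (zeroʳ (natR n)))
  Σ-comm (suc m) n f = trans (+-congˡ (Σ-comm m n (f ∘ suc))) (sym (Σ-distrib-+ n (f zero) _))

  sumΩ-cong : ∀ n {f g : Ω n → Carrier} → (∀ ω → f ω ≈ g ω) → sumΩ n f ≈ sumΩ n g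
  sumΩ-cong zero    f≈g = f≈g _
  sumΩ-cong (suc n) f≈g = Σ-cong 4 (λ k → sumΩ-cong n (λ ω → f≈g (k Vector.∷ ω)))

  sumΩ-distrib-+ : ∀ n (f g : Ω n → Carrier) → sumΩ n (λ ω → f ω + g ω) ≈ sumΩ n f + sumΩ n g
  sumΩ-distrib-+ zero    f g = refl
  sumΩ-distrib-+ (suc n) f g =
    trans (Σ-cong 4 (λ k → sumΩ-distrib-+ n (f ∘ (k Vector.∷_)) (g ∘ (k Vector.∷_))))
          (Σ-distrib-+ 4 (λ k → sumΩ n (f ∘ (k Vector.∷_))) (λ k → sumΩ n (g ∘ (k Vector.∷_))))

  sumΩ-distrib-neg : ∀ n (f : Ω n → Carrier) → sumΩ n (λ ω → - f ω) ≈ - sumΩ n f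
  sumΩ-distrib-neg zero    f = refl
  sumΩ-distrib-neg (suc n) f =
    trans (Σ-cong 4 (λ k → sumΩ-distrib-neg n (f ∘ (k Vector.∷_))))
          (Σ-distrib-neg 4 (λ k → sumΩ n (f ∘ (k Vector.∷_))))

  sumΩ-distrib-⊖ : ∀ n (f g : Ω n → Carrier) → sumΩ n (λ ω → f ω ⊖ g ω) ≈ sumΩ n f ⊖ sumΩ n g
  sumΩ-distrib-⊖ n f g = trans (sumΩ-distrib-+ n f (λ ω → - g ω)) (+-congˡ (sumΩ-distrib-neg n g))

  *-distribˡ-sumΩ : ∀ n x (f : Ω n → Carrier) → x * sumΩ n f ≈ sumΩ n (λ ω → x * f ω)
  *-distribˡ-sumΩ zero    x f = refl
  *-distribˡ-sumΩ (suc n) x f =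
    trans (*-distribˡ-Σ 4 x (λ k → sumΩ n (f ∘ (k Vector.∷_))))
          (Σ-cong 4 (λ k → *-distribˡ-sumΩ n x (f ∘ (k Vector.∷_))))

  sumΩ-const : ∀ n x → sumΩ n (λ _ → x) ≈ natR (4 ^ n) * x
  sumΩ-const zero    x = sym (trans (*-congʳ (+-identityʳ 1#)) (*-identityˡ x))
  sumΩ-const (suc n) x = begin
    Σ 4 (λ _ → sumΩ n (λ _ → x))     ≈⟨ Σ-cong 4 (λ _ → sumΩ-const n x) ⟩
    Σ 4 (λ _ → natR (4 ^ n) * x)     ≈⟨ Σ-const 4 _ ⟩
    natR 4 * (natR (4 ^ n) * x)      ≈⟨ *-assoc _ _ _ ⟨
    (natR 4 * natR (4 ^ n)) * x      ≈⟨ *-congʳ (natR-* 4 (4 ^ n)) ⟨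
    natR (4 ^ suc n) * x             ∎

  Σ-sumΩ-comm : ∀ m n (F : Fin m → Ω n → Carrier) →
    Σ m (λ k → sumΩ n (F k)) ≈ sumΩ n (λ ω → Σ m (λ k → F k ω))
  Σ-sumΩ-comm m zero    F = refl
  Σ-sumΩ-comm m (suc n) F =
    trans (Σ-comm m 4 (λ k j → sumΩ n (F k ∘ (j Vector.∷_)))) (Σ-cong 4 (λ j → Σ-sumΩ-comm m n (λ k ω → F k (j Vector.∷ ω))))


module ComplexSums {c ℓ} (R : CommutativeRing c ℓ) where
  open CommutativeRing R hiding (zero; Carrier; _≈_; _+_; _*_; -_; 0#; 1#)
  open WithRing R
  open FiniteSums R
  open import Relation.Binary.Reasoning.Setoid setoid

  _+ℂ_ : ℂ → ℂ → ℂ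
  (x , y) +ℂ (u , v) = x + u , y + v

  Σℂ : (n : ℕ) → (Fin n → ℂ) → ℂ
  Σℂ n z = Σ n (Re ∘ z) , Σ n (Im ∘ z)

  sqℂ : ℂ → ℂ
  sqℂ z = z ·ℂ z

  dot : ℂ → ℂ → Carrier
  dot z w = Re z * Re w + Im z * Im w

  Centred : (n : ℕ) → (Fin n → ℂ) → Set ℓ
  Centred n z = Σ n (Re ∘ z) ≈ 0# × Σ n (Im ∘ z) ≈ 0#

  open IntegerCoefficientRingSolver R using (Polynomial; con; _:+_; _:*_; :-_; _:-_; _:×_; solve; _:=_)

  -- Polynomial counterparts of ℂ, ·ℂ, absSq, root and Σ: their denotations are
  -- definitionally the corresponding Carrier expressions, as solve requires.
  ℂPoly : ℕ → Set
  ℂPoly m = Polynomial m × Polynomial m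

  :0 :1 : ∀ {m} → Polynomial m
  :0 = con (0 , 0)
  :1 = con (1 , 0)

  :Σ : ∀ {m} n → (Fin n → Polynomial m) → Polynomial m
  :Σ zero    f = :0
  :Σ (suc n) f = f zero :+ :Σ n (f ∘ suc)

  _:·ℂ_ : ∀ {m} → ℂPoly m → ℂPoly m → ℂPoly m
  (x , y) :·ℂ (u , v) = x :* u :- y :* v , x :* v :+ y :* u

  :absSq : ∀ {m} → ℂPoly m → Polynomial m
  :absSq (x , y) = x :* x :+ y :* y

  :root : ∀ {m} → Fin 4 → ℂPoly m
  :root zero                   = :1 , :0
  :root (suc zero)             = :0 , :1
  :root (suc (suc zero))       = :- :1 , :0
  :root (suc (suc (suc zero))) = :0 , :- :1

  absSq-·ℂ : ∀ z w → absSq (z ·ℂ w) ≈ absSq z * absSq w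
  absSq-·ℂ (x , y) (u , v) =
    solve 4 (λ x y u v → :absSq ((x , y) :·ℂ (u , v)) := :absSq (x , y) :* :absSq (u , v)) refl x y u v

  absSq-root : ∀ k → absSq (root k) ≈ 1#
  absSq-root zero                   = solve 0 (:absSq (:root zero) := :1) refl
  absSq-root (suc zero)             = solve 0 (:absSq (:root (suc zero)) := :1) refl
  absSq-root (suc (suc zero))       = solve 0 (:absSq (:root (suc (suc zero))) := :1) refl
  absSq-root (suc (suc (suc zero))) = solve 0 (:absSq (:root (suc (suc (suc zero)))) := :1) refl

  absSq-·ℂ-root : ∀ z k → absSq (z ·ℂ root k) ≈ absSq z
  absSq-·ℂ-root z k = trans (absSq-·ℂ z (root k)) (trans (*-congˡ (absSq-root k)) (*-identityʳ _))

  absSq-sqℂ-·ℂ-root : ∀ z k → absSq (sqℂ (z ·ℂ root k)) ≈ absSq z * absSq z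
  absSq-sqℂ-·ℂ-root z k =
    trans (absSq-·ℂ (z ·ℂ root k) (z ·ℂ root k)) (*-cong (absSq-·ℂ-root z k) (absSq-·ℂ-root z k))

  absSq-+ℂ : ∀ z w → absSq (z +ℂ w) ≈ (absSq z + absSq w) + (dot z w + dot z w)
  absSq-+ℂ (x , y) (u , v) = solve 4 (λ x y u v →
    (x :+ u) :* (x :+ u) :+ (y :+ v) :* (y :+ v)
    := (:absSq (x , y) :+ :absSq (u , v)) :+ ((x :* u :+ y :* v) :+ (x :* u :+ y :* v))) refl x y u v

  -- (z iᵏ)² = (−1)ᵏ z²
  sqℂ-rotations-centred : ∀ z → Centred 4 (λ k → sqℂ (z ·ℂ root k))
  sqℂ-rotations-centred (x , y) =
      solve 2 (λ x y → :Σ 4 (λ k → proj₁ (sqℂ-rotation (x , y) k)) := :0) refl x y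
    , solve 2 (λ x y → :Σ 4 (λ k → proj₂ (sqℂ-rotation (x , y) k)) := :0) refl x y
    where
    sqℂ-rotation : ∀ {m} → ℂPoly m → Fin 4 → ℂPoly m
    sqℂ-rotation z k = (z :·ℂ :root k) :·ℂ (z :·ℂ :root k)

  Σ-dot : ∀ n (u : Fin n → ℂ) w → Σ n (λ k → dot (u k) w) ≈ dot (Σℂ n u) w
  Σ-dot n u w = begin
    Σ n (λ k → Re (u k) * Re w + Im (u k) * Im w)               ≈⟨ Σ-distrib-+ n _ _ ⟩
    Σ n (λ k → Re (u k) * Re w) + Σ n (λ k → Im (u k) * Im w)   ≈⟨ +-cong (*-distribʳ-Σ n (Re w) (Re ∘ u))
                                                                          (*-distribʳ-Σ n (Im w) (Im ∘ u)) ⟨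
    dot (Σℂ n u) w                                              ∎

  dot-centred : ∀ n (u : Fin n → ℂ) w → Centred n u → dot (Σℂ n u) w ≈ 0#
  dot-centred n u w (ΣRe≈0 , ΣIm≈0) = begin
    Σ n (Re ∘ u) * Re w + Σ n (Im ∘ u) * Im w   ≈⟨ +-cong (*-congʳ ΣRe≈0) (*-congʳ ΣIm≈0) ⟩
    0# * Re w + 0# * Im w                       ≈⟨ +-cong (zeroˡ (Re w)) (zeroˡ (Im w)) ⟩
    0# + 0#                                     ≈⟨ +-identityʳ 0# ⟩
    0#                                          ∎

  Σ-absSq-+ℂ-centred : ∀ n (u : Fin n → ℂ) m → Centred n u → (∀ k → absSq (u k) ≈ m) →
    ∀ w → Σ n (λ k → absSq (u k +ℂ w)) ≈ natR n * (m + absSq w)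
  Σ-absSq-+ℂ-centred n u m centred modulus w = begin
    Σ n (λ k → absSq (u k +ℂ w))
      ≈⟨ Σ-cong n (λ k → absSq-+ℂ (u k) w) ⟩
    Σ n (λ k → (absSq (u k) + absSq w) + (dot (u k) w + dot (u k) w))
      ≈⟨ Σ-distrib-+ n _ _ ⟩
    Σ n (λ k → absSq (u k) + absSq w) + Σ n (λ k → dot (u k) w + dot (u k) w)
      ≈⟨ +-cong (Σ-cong n (λ k → +-congʳ (modulus k))) cross-terms-vanish ⟩
    Σ n (λ _ → m + absSq w) + 0#
      ≈⟨ +-identityʳ _ ⟩
    Σ n (λ _ → m + absSq w)
      ≈⟨ Σ-const n _ ⟩
    natR n * (m + absSq w) ∎
    where
    dot≈0 : Σ n (λ k → dot (u k) w) ≈ 0#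
    dot≈0 = trans (Σ-dot n u w) (dot-centred n u w centred)
    cross-terms-vanish : Σ n (λ k → dot (u k) w + dot (u k) w) ≈ 0#
    cross-terms-vanish = trans (Σ-distrib-+ n _ _) (trans (+-cong dot≈0 dot≈0) (+-identityʳ 0#))

  sumΩ-absSq-Σℂ-centred : ∀ n (u : Fin n → Fin 4 → ℂ) (m : Fin n → Carrier) →
    (∀ j → Centred 4 (u j)) → (∀ j k → absSq (u j k) ≈ m j) →
    sumΩ n (λ ω → absSq (Σℂ n (λ j → u j (ω j)))) ≈ natR (4 ^ n) * Σ n m
  sumΩ-absSq-Σℂ-centred zero    u m centred modulus =
    trans (trans (+-cong (zeroˡ 0#) (zeroˡ 0#)) (+-identityʳ 0#)) (sym (zeroʳ _))
  sumΩ-absSq-Σℂ-centred (suc n) u m centred modulus = begin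
    Σ 4 (λ k → sumΩ n (λ ω → absSq (u zero k +ℂ S ω)))
      ≈⟨ Σ-sumΩ-comm 4 n (λ k ω → absSq (u zero k +ℂ S ω)) ⟩
    sumΩ n (λ ω → Σ 4 (λ k → absSq (u zero k +ℂ S ω)))
      ≈⟨ sumΩ-cong n (λ ω → Σ-absSq-+ℂ-centred 4 (u zero) (m zero) (centred zero) (modulus zero) (S ω)) ⟩
    sumΩ n (λ ω → natR 4 * (m zero + absSq (S ω)))
      ≈⟨ *-distribˡ-sumΩ n (natR 4) _ ⟨
    natR 4 * sumΩ n (λ ω → m zero + absSq (S ω))
      ≈⟨ *-congˡ (sumΩ-distrib-+ n _ _) ⟩
    natR 4 * (sumΩ n (λ _ → m zero) + sumΩ n (absSq ∘ S))
      ≈⟨ *-congˡ (+-cong (sumΩ-const n (m zero))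
                         (sumΩ-absSq-Σℂ-centred n (u ∘ suc) (m ∘ suc) (centred ∘ suc) (modulus ∘ suc))) ⟩
    natR 4 * (natR (4 ^ n) * m zero + natR (4 ^ n) * Σ n (m ∘ suc))
      ≈⟨ *-congˡ (distribˡ _ _ _) ⟨
    natR 4 * (natR (4 ^ n) * Σ (suc n) m)
      ≈⟨ *-assoc _ _ _ ⟨
    (natR 4 * natR (4 ^ n)) * Σ (suc n) m
      ≈⟨ *-congʳ (natR-* 4 (4 ^ n)) ⟨
    natR (4 ^ suc n) * Σ (suc n) m ∎
    where
    S : Ω n → ℂ
    S ω = Σℂ n (λ j → u (suc j) (ω j))

  four-ΛSq : ∀ n (b : Fin n → ℂ) →
    natR 4 * ΛSq b ≈ (Σ n (absSq ∘ b) * Σ n (absSq ∘ b)) ⊖ absSq (Σℂ n (sqℂ ∘ b))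
  four-ΛSq n b = begin
    natR 4 * ((P * Q) ⊖ (M * M))
      ≈⟨ solve 3 (λ P Q M → (4 :× :1) :* (P :* Q :- M :* M)
                        := (P :+ Q) :* (P :+ Q) :- ((P :- Q) :* (P :- Q) :+ (M :+ M) :* (M :+ M))) refl P Q M ⟩
    ((P + Q) * (P + Q)) ⊖ ((P ⊖ Q) * (P ⊖ Q) + (M + M) * (M + M))
      ≈⟨ +-cong (*-cong P+Q≈ P+Q≈) (-‿cong (+-cong (*-cong P-Q≈ P-Q≈) (*-cong M+M≈ M+M≈))) ⟩
    (Σ n (absSq ∘ b) * Σ n (absSq ∘ b)) ⊖ absSq (Σℂ n (sqℂ ∘ b)) ∎
    where
    x y : Fin n → Carrier
    x = Re ∘ b
    y = Im ∘ b
    P Q M : Carrier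
    P = inner x x
    Q = inner y y
    M = inner x y
    P+Q≈ : P + Q ≈ Σ n (absSq ∘ b)
    P+Q≈ = sym (Σ-distrib-+ n _ _)
    P-Q≈ : P ⊖ Q ≈ Re (Σℂ n (sqℂ ∘ b))
    P-Q≈ = sym (Σ-distrib-⊖ n _ _)
    M+M≈ : M + M ≈ Im (Σℂ n (sqℂ ∘ b))
    M+M≈ = trans (sym (Σ-distrib-+ n _ _)) (Σ-cong n (λ i → +-congˡ (*-comm (x i) (y i))))


-- The identity also holds for n = 0.
proposition5p3 : ∀ {c ℓ} (R : CommutativeRing c ℓ) → let open WithRing R in
    (n : ℕ) → 1 ≤ n → (a : Fin n → ℂ) →
    natR 4 * sumΩ n (λ ω → ΛSq (hadamard a ω)) ≈ natR (4 ^ n) * (norm2⁴ a ⊖ norm4⁴ a)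
proposition5p3 R n _ a = begin
  natR 4 * sumΩ n (λ ω → ΛSq (hadamard a ω))
    ≈⟨ *-distribˡ-sumΩ n (natR 4) _ ⟩
  sumΩ n (λ ω → natR 4 * ΛSq (hadamard a ω))
    ≈⟨ sumΩ-cong n four-ΛSq-hadamard ⟩
  sumΩ n (λ ω → (S * S) ⊖ W ω)
    ≈⟨ sumΩ-distrib-⊖ n _ W ⟩
  sumΩ n (λ _ → S * S) ⊖ sumΩ n W
    ≈⟨ +-cong (sumΩ-const n (S * S)) (-‿cong signs-average-out) ⟩
  (natR (4 ^ n) * (S * S)) ⊖ (natR (4 ^ n) * norm4⁴ a)
    ≈⟨ x[y-z]≈xy-xz _ _ _ ⟨
  natR (4 ^ n) * (norm2⁴ a ⊖ norm4⁴ a) ∎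
  where
  open WithRing R
  open CommutativeRing R using (setoid; trans; +-cong; +-congʳ; *-cong; -‿cong; ring)
  open import Algebra.Properties.Ring ring using (x[y-z]≈xy-xz)
  open import Relation.Binary.Reasoning.Setoid setoid
  open FiniteSums R
  open ComplexSums R
  S : Carrier
  S = Σ n (absSq ∘ a)
  W : Ω n → Carrier
  W ω = absSq (Σℂ n (sqℂ ∘ hadamard a ω))
  four-ΛSq-hadamard : ∀ ω → natR 4 * ΛSq (hadamard a ω) ≈ (S * S) ⊖ W ω
  four-ΛSq-hadamard ω = trans (four-ΛSq n (hadamard a ω)) (+-congʳ (*-cong S≈ S≈))
    where
    S≈ : Σ n (absSq ∘ hadamard a ω) ≈ S
    S≈ = Σ-cong n (λ j → absSq-·ℂ-root (a j) (ω j))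
  signs-average-out : sumΩ n W ≈ natR (4 ^ n) * norm4⁴ a
  signs-average-out = sumΩ-absSq-Σℂ-centred n (λ j k → sqℂ (a j ·ℂ root k)) (λ j → absSq (a j) * absSq (a j))
    (λ j → sqℂ-rotations-centred (a j)) (λ j → absSq-sqℂ-·ℂ-root (a j))
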